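{- For all integers $n\ge1$ and $1\le k\le n$, the number of $e\in\mathbf{I}_n(011)$ having exactly $k$ entries equal to $0$ is the Stirling number of the second kind $S_{n,k}$, the number of partitions of an $n$-element set into $k$ nonempty blocks.
   Context: An inversion sequence of length $n$ is an integer sequence $e=(e_1,\ldots,e_n)$ with $0 \le e_i < i$ for all $i$; $\mathbf{I}_n$ is the set of these. $\mathbf{I}_n(011)$ is the set of $e\in\mathbf{I}_n$ with no indices $i<j<k$ such that $e_i<e_j=e_k$. -}

module Defs where

open import Data.Nat using (ℕ; zero; suc; _<ᵇ_; _≡ᵇ_)
open import Data.Bool using (Bool; true; false; _∧_; _∨_; not; if_then_else_)
open import Data.List using (List; []; _∷_; _++_; [_]; map; concatMap; length; filter; upTo)
open import Data.Bool.ListAction using (any; all)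
open import Data.Vec using (Vec; lookup) renaming ([] to []ᵥ; _∷_ to _∷ᵥ_)
open import Data.Fin using (Fin)
open import Data.List using () renaming (allFin to allFinL)
open import Data.Fin using (_<?_)
open import Relation.Nullary.Decidable using (⌊_⌋)

-- Inversion sequences
--   An inversion sequence of length n is a list (e₁,…,eₙ) of naturals with
--   0 ≤ eᵢ < i.  `allInv n` enumerates 𝐈ₙ, each element exactly once:
--   a sequence of length n+1 is a sequence of length n followed by a last
--   entry e_{n+1} ∈ {0,…,n}.

allInv : ℕ → List (List ℕ)
allInv zero    = [] ∷ []
allInv (suc n) = concatMap (λ e → map (λ v → e ++ [ v ]) (upTo (suc n))) (allInv n)

-- has011 e = true iff there are indices i < j < k with eᵢ < eⱼ = eₖ.
-- pairAfter x ys = true iff there are j < k (within ys) with x < y_j = y_k.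
pairAfter : ℕ → List ℕ → Bool
pairAfter x []       = false
pairAfter x (y ∷ ys) = ((x <ᵇ y) ∧ any (λ z → y ≡ᵇ z) ys) ∨ pairAfter x ys

has011 : List ℕ → Bool
has011 []       = false
has011 (x ∷ xs) = pairAfter x xs ∨ has011 xs

avoids011 : List ℕ → Bool
avoids011 e = not (has011 e)

zeros : List ℕ → ℕ
zeros e = length (filter (λ x → x Data.Nat.≟ 0) e)

countInv011Zeros : ℕ → ℕ → ℕ
countInv011Zeros n k =
  length (filter (λ e → (avoids011 e ∧ (zeros e ≡ᵇ k)) Data.Bool.≟ true) (allInv n))

-- Partitions of a set are
-- identified with equivalence relations on it (blocks = equivalence
-- classes).  A relation on Fin n is an n×n Boolean matrix; we enumerate all
-- of them, keep the equivalence relations, and count those with exactly k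
-- classes (a class is counted via its least element).

allVec : {A : Set} → (n : ℕ) → List A → List (Vec A n)
allVec zero    xs = []ᵥ ∷ []
allVec (suc n) xs = concatMap (λ x → map (x ∷ᵥ_) (allVec n xs)) xs

Rel : ℕ → Set
Rel n = Vec (Vec Bool n) n

rel : {n : ℕ} → Rel n → Fin n → Fin n → Bool
rel M i j = lookup (lookup M i) j

_⇒ᵇ_ : Bool → Bool → Bool
a ⇒ᵇ b = not a ∨ b

isEquivRel : {n : ℕ} → Rel n → Bool
isEquivRel {n} M =
  all (λ i → rel M i i) (allFinL n) ∧
  all (λ i → all (λ j → rel M i j ⇒ᵇ rel M j i) (allFinL n)) (allFinL n) ∧
  all (λ i → all (λ j → all (λ k → (rel M i j ∧ rel M j k) ⇒ᵇ rel M i k)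
                              (allFinL n)) (allFinL n)) (allFinL n)

numClasses : {n : ℕ} → Rel n → ℕ
numClasses {n} M =
  length (filter (λ i → not (any (λ j → ⌊ j <? i ⌋ ∧ rel M j i) (allFinL n)) Data.Bool.≟ true)
                 (allFinL n))

stirling2 : ℕ → ℕ → ℕ
stirling2 n k =
  length (filter (λ M → (isEquivRel M ∧ (numClasses M ≡ᵇ k)) Data.Bool.≟ true)
                 (allVec n (allVec n (false ∷ true ∷ []))))

-- Both counts satisfy the recurrence S(n+1, k) = S(n, k-1) + k S(n, k) with the same initial
-- values.
-- For partitions this is the usual argument: an equivalence relation on {0,…,n} restricts to one
-- on {1,…,n}, and 0 either forms a new class or joins one of the k existing classes. Relations
-- are Boolean matrices, split into corner, first row, first column and the rest, and a class is
-- recorded by its least element.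
-- For inversion sequences, e ∈ 𝐈ₙ(011) with n ≥ 1 starts with 0, so appending 0 keeps it
-- 011-avoiding and adds a zero, while appending a positive value v creates a 011 exactly when v
-- already occurs in e. Along the same induction, the number of values in {1,…,n} missing from e
-- equals the number of zeros of e; so e with k zeros has one extension with k + 1 zeros and k
-- extensions with k zeros.
module Submission where

open import Defs
open import Data.Nat using (ℕ; _≤_)
open import Relation.Binary.PropositionalEquality using (_≡_)

open import Algebra.Bundles using (module CommutativeMonoid)
open import Data.Bool using (Bool; true; false; _∧_; _∨_; not; T; if_then_else_)
import Data.Bool.Properties
open import Data.Bool.Properties
  using (T-∧; T-∨; T-≡; T-not-≡; ¬-not; ∧-zeroʳ; ∨-identityʳ; ∨-assoc; ∧-distribˡ-∨;
         ∨-commutativeMonoid)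
open import Data.Bool.ListAction using (any; all; or)
open import Data.Empty using (⊥-elim)
open import Data.Fin using (Fin; _<?_; toℕ) renaming (zero to fzero; suc to fsuc)
import Data.Fin.Properties as Fin
open import Data.Fin.Subset using () renaming (⊥ to ∅)
open import Data.List using (List; []; _∷_; [_]; _++_; _∷ʳ_; map; concatMap; length; filter; upTo; allFin)
open import Data.List.Properties using (map-tabulate; map-applyUpTo; applyUpTo-∷ʳ; map-cong; filter-++; length-++)
open import Data.List.Membership.Propositional using (_∈_)
open import Data.List.Relation.Unary.All using (All; []; _∷_)
import Data.List.Relation.Unary.All as All
import Data.List.Relation.Unary.All.Properties as All
open import Data.List.Relation.Unary.All.Properties using (all⁺; all⁻)
open import Data.List.Relation.Unary.Any using (here; there)
import Data.List.Relation.Unary.Any as Any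
import Data.List.Relation.Unary.Any.Properties as Any
open import Data.List.Relation.Unary.Any.Properties using (any⁺; any⁻)
open import Data.Nat using (zero; suc; _+_; _*_; _<_; _≡ᵇ_; _<ᵇ_; _≟_; z≤n; s≤s)
import Data.Nat.Properties as ℕ
open import Data.Nat.Properties
  using (+-identityʳ; +-assoc; +-comm; *-zeroʳ; *-identityʳ; *-assoc; *-comm; *-distribˡ-+; *-distribʳ-+;
         ≡ᵇ⇒≡; ≡⇒≡ᵇ)
open import Data.Product using (_×_; _,_; proj₁; proj₂; ∃-syntax)
open import Data.Sum using (inj₂; [_,_]′)
open import Data.Unit using (⊤; tt)
open import Data.Vec using (Vec; lookup; zipWith; tabulate) renaming ([] to []ᵥ; _∷_ to _∷ᵥ_)
import Data.Vec.Properties as Vec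
open import Function using (_∘_; id)
open import Function.Bundles using (Equivalence; _⇔_; mk⇔)
open import Relation.Binary.PropositionalEquality
  using (_≢_; refl; sym; trans; cong; cong₂; subst; module ≡-Reasoning)
open import Relation.Binary.Definitions using (tri<; tri≈; tri>)
open import Relation.Binary.Structures using (IsEquivalence)
open import Relation.Nullary using (¬_; Dec; yes; no)
open import Relation.Nullary.Decidable using (⌊_⌋; toWitness; fromWitness; isYes≗does)

open import Algebra.Lattice.Properties.BooleanAlgebra Data.Bool.Properties.∨-∧-booleanAlgebra
  using (deMorgan₂)
open import Algebra.Properties.CommutativeSemigroup (CommutativeMonoid.commutativeSemigroup ∨-commutativeMonoid)
  using () renaming (interchange to ∨-interchange)
open import Algebra.Properties.CommutativeSemigroup ℕ.+-commutativeSemigroup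
  using () renaming (interchange to +-interchange)

private variable
  A B : Set
  n : ℕ

-- Finite sums

infix 8 ∑
∑ : List A → (A → ℕ) → ℕ
∑ []       f = 0
∑ (x ∷ xs) f = f x + ∑ xs f

syntax ∑ xs (λ x → e) = ∑[ x ∈ xs ] e

𝟙 : Bool → ℕ
𝟙 b = if b then 1 else 0

∑-cong-∈ : (xs : List A) {f g : A → ℕ} → (∀ {x} → x ∈ xs → f x ≡ g x) → ∑ xs f ≡ ∑ xs g
∑-cong-∈ []       h = refl
∑-cong-∈ (x ∷ xs) h = cong₂ _+_ (h (here refl)) (∑-cong-∈ xs (h ∘ there))

∑-cong : (xs : List A) {f g : A → ℕ} → (∀ x → f x ≡ g x) → ∑ xs f ≡ ∑ xs g
∑-cong xs h = ∑-cong-∈ xs (λ {x} _ → h x)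

∑-zero : (xs : List A) {f : A → ℕ} → (∀ x → f x ≡ 0) → ∑ xs f ≡ 0
∑-zero []       h = refl
∑-zero (x ∷ xs) h = cong₂ _+_ (h x) (∑-zero xs h)

∑-++ : (xs ys : List A) (f : A → ℕ) → ∑ (xs ++ ys) f ≡ ∑ xs f + ∑ ys f
∑-++ []       ys f = refl
∑-++ (x ∷ xs) ys f = trans (cong (f x +_) (∑-++ xs ys f)) (sym (+-assoc (f x) _ _))

∑-+ : (xs : List A) (f g : A → ℕ) → ∑[ x ∈ xs ] (f x + g x) ≡ ∑ xs f + ∑ xs g
∑-+ []       f g = refl
∑-+ (x ∷ xs) f g = trans (cong (f x + g x +_) (∑-+ xs f g)) (+-interchange (f x) (g x) _ _)

∑-*ˡ : (xs : List A) (c : ℕ) (f : A → ℕ) → ∑[ x ∈ xs ] (c * f x) ≡ c * ∑ xs f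
∑-*ˡ []       c f = sym (*-zeroʳ c)
∑-*ˡ (x ∷ xs) c f = trans (cong (c * f x +_) (∑-*ˡ xs c f)) (sym (*-distribˡ-+ c (f x) _))

∑-*ʳ : (xs : List A) (f : A → ℕ) (c : ℕ) → ∑[ x ∈ xs ] (f x * c) ≡ ∑ xs f * c
∑-*ʳ xs f c = trans (∑-cong xs λ x → *-comm (f x) c) (trans (∑-*ˡ xs c f) (*-comm c _))

∑-map : (xs : List A) (g : A → B) (f : B → ℕ) → ∑ (map g xs) f ≡ ∑[ x ∈ xs ] f (g x)
∑-map []       g f = refl
∑-map (x ∷ xs) g f = cong (f (g x) +_) (∑-map xs g f)

∑-concatMap : (xs : List A) (g : A → List B) (f : B → ℕ) →
  ∑ (concatMap g xs) f ≡ ∑[ x ∈ xs ] ∑ (g x) f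
∑-concatMap []       g f = refl
∑-concatMap (x ∷ xs) g f =
  trans (∑-++ (g x) (concatMap g xs) f) (cong (∑ (g x) f +_) (∑-concatMap xs g f))

∑-swap : (xs : List A) (ys : List B) (f : A → B → ℕ) →
  ∑[ x ∈ xs ] ∑ ys (f x) ≡ ∑[ y ∈ ys ] ∑[ x ∈ xs ] f x y
∑-swap []       ys f = sym (∑-zero ys (λ _ → refl))
∑-swap (x ∷ xs) ys f = trans (cong (∑ ys (f x) +_) (∑-swap xs ys f)) (sym (∑-+ ys (f x) _))

𝟙-T : ∀ {a} → T a → 𝟙 a ≡ 1
𝟙-T {true} _ = refl

𝟙-¬T : ∀ {a} → ¬ T a → 𝟙 a ≡ 0
𝟙-¬T {false} _ = refl
𝟙-¬T {true}  h = ⊥-elim (h _)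

𝟙-∧ : ∀ a b → 𝟙 (a ∧ b) ≡ 𝟙 a * 𝟙 b
𝟙-∧ true  b = sym (+-identityʳ (𝟙 b))
𝟙-∧ false b = refl

𝟙≡ᵇ-* : ∀ m k → 𝟙 (m ≡ᵇ k) * m ≡ k * 𝟙 (m ≡ᵇ k)
𝟙≡ᵇ-* m k with m ≡ᵇ k in m≡ᵇk
... | true  rewrite ≡ᵇ⇒≡ m k (Equivalence.from T-≡ m≡ᵇk) = trans (+-identityʳ k) (sym (*-identityʳ k))
... | false = sym (*-zeroʳ k)

length-filter-≟true : (P : A → Bool) (xs : List A) →
  length (filter (λ x → P x Data.Bool.≟ true) xs) ≡ ∑[ x ∈ xs ] 𝟙 (P x)
length-filter-≟true P []       = refl
length-filter-≟true P (x ∷ xs) with P x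
... | true  = cong suc (length-filter-≟true P xs)
... | false = length-filter-≟true P xs

allBools : List Bool
allBools = false ∷ true ∷ []

allBoolVecs : (n : ℕ) → List (Vec Bool n)
allBoolVecs n = allVec n allBools

_≟ᵥ_ : (v w : Vec Bool n) → Dec (v ≡ w)
_≟ᵥ_ = Vec.≡-dec Data.Bool._≟_

∑-allFin-suc : (f : Fin (suc n) → ℕ) → ∑ (allFin (suc n)) f ≡ f fzero + ∑[ i ∈ allFin n ] f (fsuc i)
∑-allFin-suc {n} f =
  cong (f fzero +_) (trans (cong (λ is → ∑ is f) (sym (map-tabulate id fsuc))) (∑-map (allFin n) fsuc f))

∑-upTo-suc : (f : ℕ → ℕ) → ∑ (upTo (suc n)) f ≡ f 0 + ∑[ w ∈ upTo n ] f (suc w)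
∑-upTo-suc {n} f =
  cong (f 0 +_) (trans (cong (λ ws → ∑ ws f) (sym (map-applyUpTo id suc n))) (∑-map (upTo n) suc f))

∑-upTo-∷ʳ : (f : ℕ → ℕ) → ∑ (upTo (suc n)) f ≡ ∑ (upTo n) f + f n
∑-upTo-∷ʳ {n} f = begin
  ∑ (upTo (suc n)) f          ≡⟨ cong (λ ws → ∑ ws f) (sym (applyUpTo-∷ʳ id n)) ⟩
  ∑ (upTo n ∷ʳ n) f           ≡⟨ ∑-++ (upTo n) [ n ] f ⟩
  ∑ (upTo n) f + (f n + 0)    ≡⟨ cong (∑ (upTo n) f +_) (+-identityʳ (f n)) ⟩
  ∑ (upTo n) f + f n          ∎
  where open ≡-Reasoning

∑-allVec-suc : (xs : List A) (f : Vec A (suc n) → ℕ) →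
  ∑ (allVec (suc n) xs) f ≡ ∑[ x ∈ xs ] ∑[ v ∈ allVec n xs ] f (x ∷ᵥ v)
∑-allVec-suc {n = n} xs f = trans (∑-concatMap xs _ f) (∑-cong xs λ x → ∑-map (allVec n xs) (x ∷ᵥ_) f)

∑-allBools-point : (b : Bool) {f : Bool → ℕ} → (∀ x → x ≢ b → f x ≡ 0) → ∑ allBools f ≡ f b
∑-allBools-point false {f} h = trans (cong (λ m → f false + (m + 0)) (h true λ ())) (+-identityʳ _)
∑-allBools-point true      h = cong₂ _+_ (h false λ ()) (+-identityʳ _)

∑-allFin-point : (i : Fin n) {f : Fin n → ℕ} → (∀ j → j ≢ i → f j ≡ 0) → ∑ (allFin n) f ≡ f i
∑-allFin-point {suc n} fzero    {f} h =
  trans (∑-allFin-suc f) (trans (cong (f fzero +_) (∑-zero (allFin n) λ j → h (fsuc j) λ ())) (+-identityʳ _))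
∑-allFin-point {suc n} (fsuc i) {f} h =
  trans (∑-allFin-suc f)
        (cong₂ _+_ (h fzero λ ()) (∑-allFin-point i λ j j≢i → h (fsuc j) (j≢i ∘ Fin.suc-injective)))

∑-upTo-point : ∀ {u} → u < n → {f : ℕ → ℕ} → (∀ w → w ≢ u → f w ≡ 0) → ∑ (upTo n) f ≡ f u
∑-upTo-point {suc n} {zero}  _         {f} h =
  trans (∑-upTo-suc {n} f) (trans (cong (f 0 +_) (∑-zero (upTo n) λ w → h (suc w) λ ())) (+-identityʳ _))
∑-upTo-point {suc n} {suc u} (s≤s u<n) {f} h =
  trans (∑-upTo-suc {n} f)
        (cong₂ _+_ (h 0 λ ()) (∑-upTo-point u<n λ w w≢u → h (suc w) (w≢u ∘ ℕ.suc-injective)))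

∑-allBoolVecs-point : (c : Vec Bool n) {f : Vec Bool n → ℕ} → (∀ v → v ≢ c → f v ≡ 0) →
  ∑ (allBoolVecs n) f ≡ f c
∑-allBoolVecs-point []ᵥ h = +-identityʳ _
∑-allBoolVecs-point {suc n} (b ∷ᵥ c) {f} h = begin
  ∑ (allBoolVecs (suc n)) f
    ≡⟨ ∑-allVec-suc allBools f ⟩
  ∑[ x ∈ allBools ] ∑[ v ∈ allBoolVecs n ] f (x ∷ᵥ v)
    ≡⟨ ∑-allBools-point b (λ x x≢b → ∑-zero (allBoolVecs n) λ v →
         h (x ∷ᵥ v) (x≢b ∘ Vec.∷-injectiveˡ)) ⟩
  ∑[ v ∈ allBoolVecs n ] f (b ∷ᵥ v)
    ≡⟨ ∑-allBoolVecs-point c (λ v v≢c → h (b ∷ᵥ v) (v≢c ∘ Vec.∷-injectiveʳ)) ⟩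
  f (b ∷ᵥ c) ∎
  where open ≡-Reasoning

∑-allBoolVecs-δ : (d : Vec Bool n) (f : Vec Bool n → ℕ) →
  ∑[ c ∈ allBoolVecs n ] (𝟙 ⌊ c ≟ᵥ d ⌋ * f c) ≡ f d
∑-allBoolVecs-δ d f =
  trans (∑-allBoolVecs-point d λ c c≢d → cong (_* f c) (𝟙-¬T {⌊ c ≟ᵥ d ⌋} (c≢d ∘ toWitness)))
        (trans (cong (_* f d) (𝟙-T (fromWitness {a? = d ≟ᵥ d} refl))) (+-identityʳ (f d)))

∑-allVec-splitColumn : (n m : ℕ) (xs : List A) (g : Vec (Vec A (suc m)) n → ℕ) →
  ∑ (allVec n (allVec (suc m) xs)) g
    ≡ ∑[ c ∈ allVec n xs ] ∑[ M ∈ allVec n (allVec m xs) ] g (zipWith _∷ᵥ_ c M)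
∑-allVec-splitColumn zero    m xs g = sym (+-identityʳ _)
∑-allVec-splitColumn (suc n) m xs g = begin
  ∑ (allVec (suc n) (allVec (suc m) xs)) g
    ≡⟨ trans (∑-allVec-suc (allVec (suc m) xs) g) (∑-allVec-suc xs _) ⟩
  ∑[ x ∈ xs ] ∑[ r ∈ Rs ] ∑[ rows ∈ allVec n (allVec (suc m) xs) ] g ((x ∷ᵥ r) ∷ᵥ rows)
    ≡⟨ ∑-cong xs (λ x → ∑-cong Rs λ r →
         ∑-allVec-splitColumn n m xs λ rows → g ((x ∷ᵥ r) ∷ᵥ rows)) ⟩
  ∑[ x ∈ xs ] ∑[ r ∈ Rs ] ∑[ c ∈ Cs ] ∑[ M ∈ Ms ] g ((x ∷ᵥ r) ∷ᵥ zipWith _∷ᵥ_ c M)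
    ≡⟨ ∑-cong xs (λ x → ∑-swap Rs Cs _) ⟩
  ∑[ x ∈ xs ] ∑[ c ∈ Cs ] ∑[ r ∈ Rs ] ∑[ M ∈ Ms ] g ((x ∷ᵥ r) ∷ᵥ zipWith _∷ᵥ_ c M)
    ≡⟨ ∑-cong xs (λ x → ∑-cong Cs λ c → sym (∑-allVec-suc Rs _)) ⟩
  ∑[ x ∈ xs ] ∑[ c ∈ Cs ] ∑[ M ∈ allVec (suc n) Rs ] g (zipWith _∷ᵥ_ (x ∷ᵥ c) M)
    ≡⟨ sym (∑-allVec-suc xs _) ⟩
  ∑[ c ∈ allVec (suc n) xs ] ∑[ M ∈ allVec (suc n) Rs ] g (zipWith _∷ᵥ_ c M) ∎
  where
  open ≡-Reasoning
  Rs = allVec m xs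
  Cs = allVec n xs
  Ms = allVec n Rs

T-ext : ∀ {a b} → (T a → T b) → (T b → T a) → a ≡ b
T-ext {false} {false} _ _ = refl
T-ext {false} {true}  _ g = ⊥-elim (g _)
T-ext {true}  {false} f _ = ⊥-elim (f _)
T-ext {true}  {true}  _ _ = refl

T-not : ∀ {a} → T (not a) ⇔ (¬ T a)
T-not {false} = mk⇔ (λ _ ()) (λ _ → _)
T-not {true}  = mk⇔ (λ ()) (λ h → h _)

T-⇒ᵇ : ∀ {a b} → T (a ⇒ᵇ b) ⇔ (T a → T b)
T-⇒ᵇ {false} = mk⇔ (λ _ ()) (λ _ → _)
T-⇒ᵇ {true}  = mk⇔ (λ t _ → t) (λ h → h _)

T-all-allFin : ∀ {p : Fin n → Bool} → T (all p (allFin n)) ⇔ (∀ i → T (p i))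
T-all-allFin {n} {p} = mk⇔ (All.tabulate⁻ ∘ all⁺ p (allFin n)) (all⁻ p ∘ All.tabulate⁺)

¬T-any-allFin : ∀ {p : Fin n → Bool} → (¬ T (any p (allFin n))) ⇔ (∀ i → ¬ T (p i))
¬T-any-allFin {n} {p} = mk⇔
  (λ h i pi → h (any⁺ p (Any.tabulate⁺ i pi)))
  (λ h t → let i , pi = Any.tabulate⁻ (any⁻ p (allFin n) t) in h i pi)

any-∷ʳ : (p : A → Bool) (xs : List A) (x : A) → any p (xs ∷ʳ x) ≡ any p xs ∨ p x
any-∷ʳ p []       x = ∨-identityʳ (p x)
any-∷ʳ p (y ∷ ys) x = trans (cong (p y ∨_) (any-∷ʳ p ys x)) (sym (∨-assoc (p y) _ _))

any-false : {p : A → Bool} (xs : List A) → (∀ x → p x ≡ false) → any p xs ≡ false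
any-false []       h = refl
any-false (x ∷ xs) h = cong₂ _∨_ (h x) (any-false xs h)

any-allFin-suc : (p : Fin (suc n) → Bool) → any p (allFin (suc n)) ≡ p fzero ∨ any (p ∘ fsuc) (allFin n)
any-allFin-suc p =
  cong (λ bs → p fzero ∨ or bs) (trans (map-tabulate fsuc p) (sym (map-tabulate id (p ∘ fsuc))))

∨-absorbs-implied : ∀ {a b} → (T b → T a) → a ∨ b ≡ a
∨-absorbs-implied {true}          _ = refl
∨-absorbs-implied {false} {false} _ = refl
∨-absorbs-implied {false} {true}  h = ⊥-elim (h _)

≢⇒≡ᵇ≡false : ∀ {m n} → m ≢ n → (m ≡ᵇ n) ≡ false
≢⇒≡ᵇ≡false {m} {n} m≢n = ¬-not (m≢n ∘ ≡ᵇ⇒≡ m n ∘ Equivalence.from T-≡)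

≡ᵇ-refl : ∀ n → (n ≡ᵇ n) ≡ true
≡ᵇ-refl n = Equivalence.to T-≡ (≡⇒≡ᵇ n n refl)

-- Stirling numbers of the second kind

S₂ : ℕ → ℕ → ℕ
S₂ zero    zero    = 1
S₂ zero    (suc k) = 0
S₂ (suc n) zero    = 0
S₂ (suc n) (suc k) = S₂ n k + suc k * S₂ n (suc k)

countBy : (A → Bool) → (A → ℕ) → List A → ℕ → ℕ
countBy P N xs k = ∑[ x ∈ xs ] 𝟙 (P x ∧ (N x ≡ᵇ k))

countBy-children : (P : A → Bool) (N : A → ℕ) (xs : List A) (children : A → ℕ → ℕ) →
  (∀ {x} → x ∈ xs → ∀ k →
     children x k ≡ 𝟙 (P x ∧ (suc (N x) ≡ᵇ k)) + k * 𝟙 (P x ∧ (N x ≡ᵇ k))) →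
  ∀ k → ∑[ x ∈ xs ] children x k ≡ countBy P (suc ∘ N) xs k + k * countBy P N xs k
countBy-children P N xs children rule k =
  trans (∑-cong-∈ xs λ x∈xs → rule x∈xs k)
        (trans (∑-+ xs _ _) (cong (countBy P (suc ∘ N) xs k +_) (∑-*ˡ xs k _)))

countBy≡S₂ : {A : ℕ → Set} (xs : ∀ n → List (A n)) (P : ∀ {n} → A n → Bool)
  (N : ∀ {n} → A n → ℕ) →
  (∀ k → countBy P N (xs 0) k ≡ S₂ 0 k) →
  (∀ n k → countBy P N (xs (suc n)) k ≡ countBy P (suc ∘ N) (xs n) k + k * countBy P N (xs n) k) →
  ∀ n k → countBy P N (xs n) k ≡ S₂ n k
countBy≡S₂ xs P N base step zero    k       = base k
countBy≡S₂ xs P N base step (suc n) zero    =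
  trans (step n 0) (trans (+-identityʳ _) (∑-zero (xs n) λ x → cong 𝟙 (∧-zeroʳ (P x))))
countBy≡S₂ xs P N base step (suc n) (suc k) =
  trans (step n (suc k)) (cong₂ (λ a b → a + suc k * b) (recurse n k) (recurse n (suc k)))
  where recurse = countBy≡S₂ xs P N base step

-- Inversion sequences avoiding 011

occurs : ℕ → List ℕ → Bool
occurs v = any (_≡ᵇ v)

occursAbove : ℕ → ℕ → List ℕ → Bool
occursAbove x v = any (λ y → (x <ᵇ y) ∧ (y ≡ᵇ v))

completes011 : List ℕ → ℕ → Bool
completes011 []       v = false
completes011 (x ∷ xs) v = occursAbove x v xs ∨ completes011 xs v

pairAfter-∷ʳ : ∀ x ys v → pairAfter x (ys ∷ʳ v) ≡ pairAfter x ys ∨ occursAbove x v ys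
pairAfter-∷ʳ x []       v = cong (_∨ false) (∧-zeroʳ (x <ᵇ v))
pairAfter-∷ʳ x (y ∷ ys) v = begin
  (x<y ∧ any (y ≡ᵇ_) (ys ∷ʳ v)) ∨ pairAfter x (ys ∷ʳ v)
    ≡⟨ cong₂ (λ a b → (x<y ∧ a) ∨ b) (any-∷ʳ (y ≡ᵇ_) ys v) (pairAfter-∷ʳ x ys v) ⟩
  (x<y ∧ (any (y ≡ᵇ_) ys ∨ (y ≡ᵇ v))) ∨ (pairAfter x ys ∨ occursAbove x v ys)
    ≡⟨ cong (_∨ _) (∧-distribˡ-∨ x<y _ _) ⟩
  ((x<y ∧ any (y ≡ᵇ_) ys) ∨ (x<y ∧ (y ≡ᵇ v))) ∨ (pairAfter x ys ∨ occursAbove x v ys)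
    ≡⟨ ∨-interchange (x<y ∧ any (y ≡ᵇ_) ys) (x<y ∧ (y ≡ᵇ v)) (pairAfter x ys) (occursAbove x v ys) ⟩
  pairAfter x (y ∷ ys) ∨ occursAbove x v (y ∷ ys) ∎
  where
  open ≡-Reasoning
  x<y = x <ᵇ y

has011-∷ʳ : ∀ e v → has011 (e ∷ʳ v) ≡ has011 e ∨ completes011 e v
has011-∷ʳ []       v = refl
has011-∷ʳ (x ∷ xs) v = trans (cong₂ _∨_ (pairAfter-∷ʳ x xs v) (has011-∷ʳ xs v))
  (∨-interchange (pairAfter x xs) (occursAbove x v xs) (has011 xs) (completes011 xs v))

completes011-zero : ∀ e → completes011 e 0 ≡ false
completes011-zero []       = refl
completes011-zero (x ∷ xs) = cong₂ _∨_ (any-false xs never) (completes011-zero xs)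
  where
  never : ∀ y → ((x <ᵇ y) ∧ (y ≡ᵇ 0)) ≡ false
  never zero    = refl
  never (suc y) = ∧-zeroʳ _

occursAbove⇒occurs : ∀ x v ys → T (occursAbove x v ys) → T (occurs v ys)
occursAbove⇒occurs x v ys = any⁺ _ ∘ Any.map (λ {y} → proj₂ ∘ Equivalence.to (T-∧ {x <ᵇ y})) ∘ any⁻ _ ys

completes011⇒occurs : ∀ e v → T (completes011 e v) → T (occurs v e)
completes011⇒occurs (x ∷ xs) v =
  Equivalence.from T-∨ ∘ inj₂ ∘ [ occursAbove⇒occurs x v xs , completes011⇒occurs xs v ]′
    ∘ Equivalence.to T-∨

StartsWithZero : List ℕ → Set
StartsWithZero []      = ⊤
StartsWithZero (x ∷ _) = x ≡ 0

completes011-suc : ∀ e w → StartsWithZero e → completes011 e (suc w) ≡ occurs (suc w) e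
completes011-suc []        w _    = refl
completes011-suc (.0 ∷ xs) w refl =
  trans (cong (λ b → or b ∨ completes011 xs (suc w)) (map-cong above0 xs))
        (∨-absorbs-implied (completes011⇒occurs xs (suc w)))
  where
  above0 : ∀ y → ((0 <ᵇ y) ∧ (y ≡ᵇ suc w)) ≡ (y ≡ᵇ suc w)
  above0 zero    = refl
  above0 (suc y) = refl

avoids011-∷ʳ-zero : ∀ e → avoids011 (e ∷ʳ 0) ≡ avoids011 e
avoids011-∷ʳ-zero e =
  cong not (trans (has011-∷ʳ e 0) (trans (cong (has011 e ∨_) (completes011-zero e)) (∨-identityʳ _)))

avoids011-∷ʳ-suc : ∀ e w → StartsWithZero e →
  avoids011 (e ∷ʳ suc w) ≡ avoids011 e ∧ not (occurs (suc w) e)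
avoids011-∷ʳ-suc e w e₁≡0 =
  trans (cong not (trans (has011-∷ʳ e (suc w)) (cong (has011 e ∨_) (completes011-suc e w e₁≡0))))
        (deMorgan₂ (has011 e) (occurs (suc w) e))

zeros-∷ʳ : ∀ e v → zeros (e ∷ʳ v) ≡ zeros e + zeros [ v ]
zeros-∷ʳ e v = trans (cong length (filter-++ (_≟ 0) e [ v ])) (length-++ (filter (_≟ 0) e))

occurs-bounded : ∀ {m e} → All (_< m) e → occurs m e ≡ false
occurs-bounded []           = refl
occurs-bounded (y<m ∷ y<ms) = cong₂ _∨_ (≢⇒≡ᵇ≡false (ℕ.<⇒≢ y<m)) (occurs-bounded y<ms)

missing : ℕ → List ℕ → ℕ
missing n e = ∑[ w ∈ upTo n ] 𝟙 (not (occurs (suc w) e))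

missing-suc : ∀ {e} → All (_< suc n) e → missing (suc n) e ≡ missing n e + 1
missing-suc {n} {e} bounded = trans (∑-upTo-∷ʳ {n} λ w → 𝟙 (not (occurs (suc w) e)))
  (cong (λ b → missing n e + 𝟙 (not b)) (occurs-bounded bounded))

missing-∷ʳ-zero : ∀ n e → missing n (e ∷ʳ 0) ≡ missing n e
missing-∷ʳ-zero n e = ∑-cong (upTo n) λ w → cong (𝟙 ∘ not) (trans (any-∷ʳ _ e 0) (∨-identityʳ _))

missing-∷ʳ-suc : ∀ {u} e → u < n → occurs (suc u) e ≡ false → missing n (e ∷ʳ suc u) + 1 ≡ missing n e
missing-∷ʳ-suc {n} {u} e u<n fresh = begin
  missing n (e ∷ʳ suc u) + 1
    ≡⟨ cong₂ _+_ (∑-cong (upTo n) λ w → cong (𝟙 ∘ not) (any-∷ʳ _ e (suc u)))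
                 (sym (trans (∑-upTo-point u<n δ-off) (cong 𝟙 (≡ᵇ-refl u)))) ⟩
  ∑[ w ∈ upTo n ] 𝟙 (not (occurs (suc w) e ∨ (u ≡ᵇ w))) + ∑[ w ∈ upTo n ] 𝟙 (u ≡ᵇ w)
    ≡⟨ sym (∑-+ (upTo n) _ _) ⟩
  ∑[ w ∈ upTo n ] (𝟙 (not (occurs (suc w) e ∨ (u ≡ᵇ w))) + 𝟙 (u ≡ᵇ w))
    ≡⟨ ∑-cong (upTo n) split ⟩
  missing n e ∎
  where
  open ≡-Reasoning
  δ-off : ∀ w → w ≢ u → 𝟙 (u ≡ᵇ w) ≡ 0
  δ-off w w≢u = cong 𝟙 (≢⇒≡ᵇ≡false (w≢u ∘ sym))
  split : ∀ w → 𝟙 (not (occurs (suc w) e ∨ (u ≡ᵇ w))) + 𝟙 (u ≡ᵇ w) ≡ 𝟙 (not (occurs (suc w) e))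
  split w with u ≡ᵇ w in u≡ᵇw
  ... | false = trans (+-identityʳ _) (cong (𝟙 ∘ not) (∨-identityʳ _))
  ... | true  rewrite sym (≡ᵇ⇒≡ u w (Equivalence.from T-≡ u≡ᵇw)) | fresh = refl

startsWithZero-∷ʳ : ∀ {e v} → length e ≡ n → StartsWithZero e → v < suc n → StartsWithZero (e ∷ʳ v)
startsWithZero-∷ʳ {e = []}    refl _     (s≤s z≤n) = refl
startsWithZero-∷ʳ {e = _ ∷ _} _    e₁≡0 _         = e₁≡0

record Invariant (n : ℕ) (e : List ℕ) : Set where
  field
    length≡        : length e ≡ n
    bounded        : All (_< n) e
    startsWithZero : StartsWithZero e
    missing≡zeros  : T (avoids011 e) → missing n e ≡ zeros e

invariant-∷ʳ : ∀ {e v} → Invariant n e → v < suc n → Invariant (suc n) (e ∷ʳ v)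
invariant-∷ʳ {n} {e} {v} inv v≤n = record
  { length≡        = trans (length-++ e) (trans (cong (_+ 1) length≡) (+-comm n 1))
  ; bounded        = bounded′ v≤n
  ; startsWithZero = startsWithZero-∷ʳ length≡ startsWithZero v≤n
  ; missing≡zeros  = missing≡zeros′ v v≤n
  }
  where
  open Invariant inv
  open ≡-Reasoning
  bounded′ : ∀ {v} → v < suc n → All (_< suc n) (e ∷ʳ v)
  bounded′ = All.∷ʳ⁺ (All.map ℕ.m<n⇒m<1+n bounded)
  missing≡zeros′ : ∀ v → v < suc n → T (avoids011 (e ∷ʳ v)) →
    missing (suc n) (e ∷ʳ v) ≡ zeros (e ∷ʳ v)
  missing≡zeros′ zero    0≤n       avoids = begin
    missing (suc n) (e ∷ʳ 0)  ≡⟨ missing-suc (bounded′ 0≤n) ⟩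
    missing n (e ∷ʳ 0) + 1    ≡⟨ cong (_+ 1) (missing-∷ʳ-zero n e) ⟩
    missing n e + 1           ≡⟨ cong (_+ 1) (missing≡zeros (subst T (avoids011-∷ʳ-zero e) avoids)) ⟩
    zeros e + 1               ≡⟨ sym (zeros-∷ʳ e 0) ⟩
    zeros (e ∷ʳ 0)            ∎
  missing≡zeros′ (suc u) (s≤s u<n) avoids = begin
    missing (suc n) (e ∷ʳ suc u)  ≡⟨ missing-suc (bounded′ (s≤s u<n)) ⟩
    missing n (e ∷ʳ suc u) + 1    ≡⟨ missing-∷ʳ-suc e u<n (Equivalence.to T-not-≡ fresh) ⟩
    missing n e                   ≡⟨ missing≡zeros avoids-e ⟩
    zeros e                       ≡⟨ sym (trans (zeros-∷ʳ e (suc u)) (+-identityʳ _)) ⟩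
    zeros (e ∷ʳ suc u)            ∎
    where
    avoids-e×fresh : T (avoids011 e) × T (not (occurs (suc u) e))
    avoids-e×fresh = Equivalence.to T-∧ (subst T (avoids011-∷ʳ-suc e u startsWithZero) avoids)
    avoids-e = proj₁ avoids-e×fresh
    fresh = proj₂ avoids-e×fresh

allInv-invariant : ∀ n → All (Invariant n) (allInv n)
allInv-invariant zero    =
  record { length≡ = refl ; bounded = [] ; startsWithZero = tt ; missing≡zeros = λ _ → refl } ∷ []
allInv-invariant (suc n) = All.concat⁺ (All.map⁺ (All.map
  (λ inv → All.map⁺ (All.applyUpTo⁺₁ id (suc n) (invariant-∷ʳ inv)))
  (allInv-invariant n)))

countBy-∷ʳ : ∀ {e} → Invariant n e → ∀ k →
  countBy avoids011 zeros (map (e ∷ʳ_) (upTo (suc n))) k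
    ≡ 𝟙 (avoids011 e ∧ (suc (zeros e) ≡ᵇ k)) + k * 𝟙 (avoids011 e ∧ (zeros e ≡ᵇ k))
countBy-∷ʳ {n} {e} inv k = begin
  countBy avoids011 zeros (map (e ∷ʳ_) (upTo (suc n))) k
    ≡⟨ trans (∑-map (upTo (suc n)) (e ∷ʳ_) F) (∑-upTo-suc {n} (F ∘ (e ∷ʳ_))) ⟩
  F (e ∷ʳ 0) + ∑[ w ∈ upTo n ] F (e ∷ʳ suc w)
    ≡⟨ cong₂ _+_ zero-value (∑-cong (upTo n) fresh-value) ⟩
  new-zero + ∑[ w ∈ upTo n ] (c * 𝟙 (not (occurs (suc w) e)))
    ≡⟨ cong (new-zero +_) (trans (∑-*ˡ (upTo n) c _) (scale (avoids011 e) missing≡zeros)) ⟩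
  new-zero + k * c ∎
  where
  open ≡-Reasoning
  open Invariant inv
  F : List ℕ → ℕ
  F y = 𝟙 (avoids011 y ∧ (zeros y ≡ᵇ k))
  new-zero = 𝟙 (avoids011 e ∧ (suc (zeros e) ≡ᵇ k))
  c = 𝟙 (avoids011 e ∧ (zeros e ≡ᵇ k))
  rearrange : ∀ a b z → 𝟙 ((a ∧ b) ∧ z) ≡ 𝟙 (a ∧ z) * 𝟙 b
  rearrange false b     z     = refl
  rearrange true  false false = refl
  rearrange true  false true  = refl
  rearrange true  true  false = refl
  rearrange true  true  true  = refl
  zero-value : F (e ∷ʳ 0) ≡ new-zero
  zero-value = cong₂ (λ a z → 𝟙 (a ∧ (z ≡ᵇ k)))
    (avoids011-∷ʳ-zero e) (trans (zeros-∷ʳ e 0) (+-comm (zeros e) 1))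
  fresh-value : ∀ w → F (e ∷ʳ suc w) ≡ c * 𝟙 (not (occurs (suc w) e))
  fresh-value w = trans
    (cong₂ (λ a z → 𝟙 (a ∧ (z ≡ᵇ k)))
      (avoids011-∷ʳ-suc e w startsWithZero) (trans (zeros-∷ʳ e (suc w)) (+-identityʳ _)))
    (rearrange (avoids011 e) _ _)
  scale : ∀ a → (T a → missing n e ≡ zeros e) →
    𝟙 (a ∧ (zeros e ≡ᵇ k)) * missing n e ≡ k * 𝟙 (a ∧ (zeros e ≡ᵇ k))
  scale false _ = sym (*-zeroʳ k)
  scale true  h = trans (cong (𝟙 (zeros e ≡ᵇ k) *_) (h _)) (𝟙≡ᵇ-* (zeros e) k)

countInv011Zeros≡S₂ : ∀ n k → countInv011Zeros n k ≡ S₂ n k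
countInv011Zeros≡S₂ n k =
  trans (length-filter-≟true _ (allInv n)) (countBy≡S₂ allInv avoids011 zeros base step n k)
  where
  base : ∀ k → countBy avoids011 zeros (allInv 0) k ≡ S₂ 0 k
  base zero    = refl
  base (suc k) = refl
  step : ∀ n k → countBy avoids011 zeros (allInv (suc n)) k
               ≡ countBy avoids011 (suc ∘ zeros) (allInv n) k + k * countBy avoids011 zeros (allInv n) k
  step n k = trans (∑-concatMap (allInv n) _ _) (countBy-children avoids011 zeros (allInv n) _
    (λ e∈allInv → countBy-∷ʳ (All.lookup (allInv-invariant n) e∈allInv)) k)

-- Equivalence relations as Boolean matrices

allRels : (n : ℕ) → List (Rel n)
allRels n = allVec n (allBoolVecs n)

⟦_⟧ : (Fin n → Fin n → Bool) → Fin n → Fin n → Set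
⟦ R ⟧ i j = T (R i j)

isEquivRel-correct : (M : Rel n) → T (isEquivRel M) ⇔ IsEquivalence ⟦ rel M ⟧
isEquivRel-correct {n} M = mk⇔ decode encode
  where
  open Equivalence
  Fs = allFin n
  reflᵇ  = all (λ i → rel M i i) Fs
  symᵇ   = all (λ i → all (λ j → rel M i j ⇒ᵇ rel M j i) Fs) Fs
  transᵇ = all (λ i → all (λ j → all (λ k → (rel M i j ∧ rel M j k) ⇒ᵇ rel M i k) Fs) Fs) Fs
  decode : T (reflᵇ ∧ symᵇ ∧ transᵇ) → IsEquivalence ⟦ rel M ⟧
  decode t = record
    { refl  = λ {i} → T-all-allFin .to r i
    ; sym   = λ {i} {j} → T-⇒ᵇ .to (T-all-allFin .to (T-all-allFin .to s i) j)
    ; trans = λ {i} {j} {k} p q →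
        T-⇒ᵇ .to (T-all-allFin .to (T-all-allFin .to (T-all-allFin .to tr i) j) k) (T-∧ .from (p , q))
    }
    where
    r : T reflᵇ
    r = proj₁ (T-∧ .to t)
    s : T symᵇ
    s = proj₁ (T-∧ .to (proj₂ (T-∧ {reflᵇ} .to t)))
    tr : T transᵇ
    tr = proj₂ (T-∧ {symᵇ} .to (proj₂ (T-∧ {reflᵇ} .to t)))
  encode : IsEquivalence ⟦ rel M ⟧ → T (reflᵇ ∧ symᵇ ∧ transᵇ)
  encode eq = T-∧ .from (r , T-∧ .from (s , tr))
    where
    module E = IsEquivalence eq
    r : T reflᵇ
    r = T-all-allFin {n} .from λ i → E.refl
    s : T symᵇ
    s = T-all-allFin {n} .from λ i → T-all-allFin {n} .from λ j → T-⇒ᵇ .from E.sym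
    tr : T transᵇ
    tr = T-all-allFin {n} .from λ i → T-all-allFin {n} .from λ j → T-all-allFin {n} .from λ k →
      T-⇒ᵇ .from λ pq → E.trans (proj₁ (T-∧ .to pq)) (proj₂ (T-∧ .to pq))

isEquivalence-≗ : {R S : Fin n → Fin n → Bool} → (∀ x y → R x y ≡ S x y) →
  IsEquivalence ⟦ R ⟧ → IsEquivalence ⟦ S ⟧
isEquivalence-≗ {R = R} {S} R≗S eq = record
  { refl  = to E.refl
  ; sym   = to ∘ E.sym ∘ from
  ; trans = λ p q → to (E.trans (from p) (from q))
  }
  where
  module E = IsEquivalence eq
  to : ∀ {x y} → ⟦ R ⟧ x y → ⟦ S ⟧ x y
  to {x} {y} = subst T (R≗S x y)
  from : ∀ {x y} → ⟦ S ⟧ x y → ⟦ R ⟧ x y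
  from {x} {y} = subst T (sym (R≗S x y))

vec-ext : {v w : Vec A n} → (∀ i → lookup v i ≡ lookup w i) → v ≡ w
vec-ext {v = v} {w} v≗w =
  trans (sym (Vec.tabulate∘lookup v)) (trans (Vec.tabulate-cong v≗w) (Vec.tabulate∘lookup w))

bordered : Bool → Vec Bool n → Vec Bool n → Rel n → Rel (suc n)
bordered b r c M = (b ∷ᵥ r) ∷ᵥ zipWith _∷ᵥ_ c M

borderedRel : Bool → Vec Bool n → Vec Bool n → (Fin n → Fin n → Bool) → Fin (suc n) → Fin (suc n) → Bool
borderedRel b r c R fzero    fzero    = b
borderedRel b r c R fzero    (fsuc j) = lookup r j
borderedRel b r c R (fsuc i) fzero    = lookup c i
borderedRel b r c R (fsuc i) (fsuc j) = R i j

rel-bordered : ∀ b r c (M : Rel n) x y → rel (bordered b r c M) x y ≡ borderedRel b r c (rel M) x y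
rel-bordered b r c M fzero    fzero    = refl
rel-bordered b r c M fzero    (fsuc j) = refl
rel-bordered b r c M (fsuc i) fzero    = cong (λ row → lookup row fzero) (Vec.lookup-zipWith _∷ᵥ_ i c M)
rel-bordered b r c M (fsuc i) (fsuc j) = cong (λ row → lookup row (fsuc j)) (Vec.lookup-zipWith _∷ᵥ_ i c M)

∑-allRels-suc : (G : Rel (suc n) → ℕ) →
  ∑ (allRels (suc n)) G
    ≡ ∑[ M ∈ allRels n ] ∑[ b ∈ allBools ] ∑[ r ∈ allBoolVecs n ] ∑[ c ∈ allBoolVecs n ] G (bordered b r c M)
∑-allRels-suc {n} G = begin
  ∑ (allRels (suc n)) G
    ≡⟨ trans (∑-allVec-suc (allBoolVecs (suc n)) G) (∑-allVec-suc {n = n} allBools _) ⟩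
  ∑[ b ∈ allBools ] ∑[ r ∈ Vs ] ∑[ rows ∈ allVec n (allBoolVecs (suc n)) ] G ((b ∷ᵥ r) ∷ᵥ rows)
    ≡⟨ ∑-cong allBools (λ b → ∑-cong Vs λ r →
         ∑-allVec-splitColumn n n allBools λ rows → G ((b ∷ᵥ r) ∷ᵥ rows)) ⟩
  ∑[ b ∈ allBools ] ∑[ r ∈ Vs ] ∑[ c ∈ Vs ] ∑[ M ∈ allRels n ] G (bordered b r c M)
    ≡⟨ ∑-cong allBools (λ b → ∑-cong Vs λ r → ∑-swap Vs (allRels n) λ c M → G (bordered b r c M)) ⟩
  ∑[ b ∈ allBools ] ∑[ r ∈ Vs ] ∑[ M ∈ allRels n ] ∑[ c ∈ Vs ] G (bordered b r c M)
    ≡⟨ ∑-cong allBools (λ b → ∑-swap Vs (allRels n) λ r M → ∑[ c ∈ Vs ] G (bordered b r c M)) ⟩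
  ∑[ b ∈ allBools ] ∑[ M ∈ allRels n ] ∑[ r ∈ Vs ] ∑[ c ∈ Vs ] G (bordered b r c M)
    ≡⟨ ∑-swap allBools (allRels n) (λ b M → ∑[ r ∈ Vs ] ∑[ c ∈ Vs ] G (bordered b r c M)) ⟩
  ∑[ M ∈ allRels n ] ∑[ b ∈ allBools ] ∑[ r ∈ Vs ] ∑[ c ∈ Vs ] G (bordered b r c M) ∎
  where
  open ≡-Reasoning
  Vs = allBoolVecs n

record EmptyOrClass (R : Fin n → Fin n → Bool) (c : Vec Bool n) : Set where
  field
    closed    : ∀ {i j} → T (lookup c i) → ⟦ R ⟧ i j → T (lookup c j)
    connected : ∀ {i j} → T (lookup c i) → T (lookup c j) → ⟦ R ⟧ i j

borderedRel-isEquivalence⁻ : ∀ {b r c R} → IsEquivalence ⟦ borderedRel {n} b r c R ⟧ →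
  T b × r ≡ c × IsEquivalence ⟦ R ⟧ × EmptyOrClass R c
borderedRel-isEquivalence⁻ {b = b} {r} {c} {R} eq = E.refl {fzero} , r≡c , R-isEquivalence , c-emptyOrClass
  where
  module E = IsEquivalence eq
  r≡c : r ≡ c
  r≡c = vec-ext λ i → T-ext (E.sym {fzero} {fsuc i}) (E.sym {fsuc i} {fzero})
  R-isEquivalence : IsEquivalence ⟦ R ⟧
  R-isEquivalence = record
    { refl  = λ {i} → E.refl {fsuc i}
    ; sym   = λ {i} {j} → E.sym {fsuc i} {fsuc j}
    ; trans = λ {i} {j} {k} → E.trans {fsuc i} {fsuc j} {fsuc k}
    }
  c-emptyOrClass : EmptyOrClass R c
  c-emptyOrClass = record
    { closed    = λ {i} {j} ci Rij → E.trans {fsuc j} {fsuc i} {fzero} (E.sym {fsuc i} {fsuc j} Rij) ci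
    ; connected = λ {i} {j} ci cj → E.trans {fsuc i} {fzero} {fsuc j} ci (E.sym {fsuc j} {fzero} cj)
    }

borderedRel-isEquivalence⁺ : ∀ {c R} → IsEquivalence ⟦ R ⟧ → EmptyOrClass R c →
  IsEquivalence ⟦ borderedRel {n} true c c R ⟧
borderedRel-isEquivalence⁺ {c = c} {R} eq block = record
  { refl  = λ {x} → refl′ x
  ; sym   = λ {x} {y} → sym′ x y
  ; trans = λ {x} {y} {z} → trans′ x y z
  }
  where
  module E = IsEquivalence eq
  open EmptyOrClass block
  R′ = ⟦ borderedRel true c c R ⟧
  refl′ : ∀ x → R′ x x
  refl′ fzero    = _
  refl′ (fsuc i) = E.refl
  sym′ : ∀ x y → R′ x y → R′ y x
  sym′ fzero    fzero    = id
  sym′ fzero    (fsuc j) = id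
  sym′ (fsuc i) fzero    = id
  sym′ (fsuc i) (fsuc j) = E.sym
  trans′ : ∀ x y z → R′ x y → R′ y z → R′ x z
  trans′ fzero    _        fzero    _ _ = _
  trans′ fzero    fzero    (fsuc k) _ q = q
  trans′ fzero    (fsuc j) (fsuc k) p q = closed p q
  trans′ (fsuc i) fzero    fzero    p _ = p
  trans′ (fsuc i) fzero    (fsuc k) p q = connected p q
  trans′ (fsuc i) (fsuc j) fzero    p q = closed q (E.sym p)
  trans′ (fsuc i) (fsuc j) (fsuc k) p q = E.trans p q

isEquivRel-bordered : ∀ b r c (M : Rel n) →
  T (isEquivRel (bordered b r c M)) ⇔ IsEquivalence ⟦ borderedRel b r c (rel M) ⟧
isEquivRel-bordered b r c M = mk⇔
  (isEquivalence-≗ (rel-bordered b r c M) ∘ Equivalence.to (isEquivRel-correct (bordered b r c M)))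
  (Equivalence.from (isEquivRel-correct (bordered b r c M)) ∘ isEquivalence-≗ λ x y → sym (rel-bordered b r c M x y))

∑-bordered-diagonal : (M : Rel n) (G : Rel (suc n) → ℕ) → (∀ M′ → ¬ T (isEquivRel M′) → G M′ ≡ 0) →
  ∑[ b ∈ allBools ] ∑[ r ∈ allBoolVecs n ] ∑[ c ∈ allBoolVecs n ] G (bordered b r c M)
    ≡ ∑[ c ∈ allBoolVecs n ] G (bordered true c c M)
∑-bordered-diagonal {n} M G G-vanishes =
  trans (∑-allBools-point true λ b b≢true → ∑-zero Vs λ r → ∑-zero Vs λ c →
           G-vanishes (bordered b r c M) (b≢true ∘ Equivalence.to T-≡ ∘ proj₁ ∘ shape {b} {r} {c}))
        (∑-cong Vs λ r → ∑-allBoolVecs-point r λ c c≢r →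
           G-vanishes (bordered true r c M) (c≢r ∘ sym ∘ proj₂ ∘ shape {true} {r} {c}))
  where
  Vs = allBoolVecs n
  shape : ∀ {b r c} → T (isEquivRel (bordered b r c M)) → T b × r ≡ c
  shape {b} {r} {c} t =
    let Tb , r≡c , _ = borderedRel-isEquivalence⁻ (Equivalence.to (isEquivRel-bordered b r c M) t) in Tb , r≡c

-- Counting classes by their least elements

isMin : (Fin n → Fin n → Bool) → Fin n → Bool
isMin {n} R i = not (any (λ j → ⌊ j <? i ⌋ ∧ R j i) (allFin n))

countMinima : (Fin n → Fin n → Bool) → ℕ
countMinima {n} R = ∑[ i ∈ allFin n ] 𝟙 (isMin R i)

countMinimaOutside : Vec Bool n → (Fin n → Fin n → Bool) → ℕ
countMinimaOutside {n} c R = ∑[ i ∈ allFin n ] 𝟙 (not (lookup c i) ∧ isMin R i)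

numClasses≡countMinima : (M : Rel n) → numClasses M ≡ countMinima (rel M)
numClasses≡countMinima {n} M = length-filter-≟true (isMin (rel M)) (allFin n)

isMin-correct : ∀ {R : Fin n → Fin n → Bool} {i} →
  T (isMin R i) ⇔ (∀ j → toℕ j < toℕ i → ¬ ⟦ R ⟧ j i)
isMin-correct {n} {R} {i} = mk⇔
  (λ t j j<i Rji →
     ¬T-any-allFin {p = earlier} .to (T-not .to t) j (T-∧ {⌊ j <? i ⌋} .from (fromWitness j<i , Rji)))
  (λ h → T-not .from (¬T-any-allFin {p = earlier} .from λ j t →
     let j<i , Rji = T-∧ {⌊ j <? i ⌋} .to t in h j (toWitness j<i) Rji))
  where
  open Equivalence
  earlier : Fin n → Bool
  earlier j = ⌊ j <? i ⌋ ∧ R j i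

isMin-unique : ∀ {R : Fin n → Fin n → Bool} {i j} → IsEquivalence ⟦ R ⟧ →
  T (isMin R i) → T (isMin R j) → ⟦ R ⟧ i j → i ≡ j
isMin-unique {R = R} {i} {j} eq min-i min-j Rij with Fin.<-cmp i j
... | tri< i<j _ _ = ⊥-elim (Equivalence.to (isMin-correct {R = R}) min-j i i<j Rij)
... | tri≈ _ i≡j _ = i≡j
... | tri> _ _ j<i = ⊥-elim (Equivalence.to (isMin-correct {R = R}) min-i j j<i (IsEquivalence.sym eq Rij))

isMin-cong : ∀ {R S : Fin n → Fin n → Bool} → (∀ x y → R x y ≡ S x y) → ∀ i → isMin R i ≡ isMin S i
isMin-cong {n} R≗S i = cong (not ∘ or) (map-cong (λ j → cong (⌊ j <? i ⌋ ∧_) (R≗S j i)) (allFin n))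

isMin-zero : (R : Fin (suc n) → Fin (suc n) → Bool) → isMin R fzero ≡ true
isMin-zero {n} R = cong not (any-false (allFin (suc n)) λ _ → refl)

isMin-borderedRel-suc : ∀ b r c (R : Fin n → Fin n → Bool) i →
  isMin (borderedRel b r c R) (fsuc i) ≡ not (lookup r i) ∧ isMin R i
isMin-borderedRel-suc {n} b r c R i = trans
  (cong not (trans (any-allFin-suc {n} λ j → ⌊ j <? fsuc i ⌋ ∧ borderedRel b r c R j (fsuc i))
                   (cong (λ bs → lookup r i ∨ or bs) (map-cong <?-suc (allFin n)))))
  (deMorgan₂ (lookup r i) _)
  where
  <?-suc : ∀ j → (⌊ fsuc j <? fsuc i ⌋ ∧ R j i) ≡ (⌊ j <? i ⌋ ∧ R j i)
  <?-suc j = cong (_∧ R j i) (trans (isYes≗does (fsuc j <? fsuc i)) (sym (isYes≗does (j <? i))))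

countMinima-bordered : ∀ b r c (M : Rel n) → countMinima (rel (bordered b r c M)) ≡ suc (countMinimaOutside r (rel M))
countMinima-bordered {n} b r c M = begin
  countMinima (rel (bordered b r c M))
    ≡⟨ ∑-cong (allFin (suc n)) (cong 𝟙 ∘ isMin-cong (rel-bordered b r c M)) ⟩
  ∑[ x ∈ allFin (suc n) ] 𝟙 (isMin R′ x)
    ≡⟨ ∑-allFin-suc {n} (𝟙 ∘ isMin R′) ⟩
  𝟙 (isMin R′ fzero) + ∑[ i ∈ allFin n ] 𝟙 (isMin R′ (fsuc i))
    ≡⟨ cong₂ _+_ (cong 𝟙 (isMin-zero R′))
                 (∑-cong (allFin n) (cong 𝟙 ∘ isMin-borderedRel-suc b r c (rel M))) ⟩
  suc (countMinimaOutside r (rel M)) ∎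
  where
  open ≡-Reasoning
  R′ = borderedRel b r c (rel M)

row : (Fin n → Fin n → Bool) → Fin n → Vec Bool n
row R i = tabulate (R i)

emptyOrClass-∅ : ∀ {R : Fin n → Fin n → Bool} → EmptyOrClass R ∅
emptyOrClass-∅ = record
  { closed    = λ {i} t _ → ⊥-elim (subst T (Vec.lookup-replicate i false) t)
  ; connected = λ {i} t _ → ⊥-elim (subst T (Vec.lookup-replicate i false) t)
  }

emptyOrClass-row : ∀ {R : Fin n → Fin n → Bool} → IsEquivalence ⟦ R ⟧ → ∀ i → EmptyOrClass R (row R i)
emptyOrClass-row {R = R} eq i = record
  { closed    = λ {j} {k} Rij Rjk → subst T (sym (lookup-row k)) (E.trans (subst T (lookup-row j) Rij) Rjk)
  ; connected = λ {j} {k} Rij Rik → E.trans (E.sym (subst T (lookup-row j) Rij)) (subst T (lookup-row k) Rik)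
  }
  where
  module E = IsEquivalence eq
  lookup-row : ∀ j → lookup (row R i) j ≡ R i j
  lookup-row = Vec.lookup∘tabulate (R i)

emptyOrClass⇒≡row : ∀ {R : Fin n → Fin n → Bool} {c m} → EmptyOrClass R c → T (lookup c m) → c ≡ row R m
emptyOrClass⇒≡row {R = R} {c} {m} block cm =
  vec-ext λ j → trans (T-ext (connected cm) (closed cm)) (sym (Vec.lookup∘tabulate (R m) j))
  where open EmptyOrClass block

row-nonempty : ∀ {R : Fin n → Fin n → Bool} → IsEquivalence ⟦ R ⟧ → ∀ i → row R i ≢ ∅
row-nonempty {R = R} eq i row≡∅ = subst T (Vec.lookup-replicate i false)
  (subst (λ v → T (lookup v i)) row≡∅ (subst T (sym (Vec.lookup∘tabulate (R i) i)) (IsEquivalence.refl eq)))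

leastMember : (c : Vec Bool n) → c ≢ ∅ →
  ∃[ m ] (T (lookup c m) × (∀ j → toℕ j < toℕ m → ¬ T (lookup c j)))
leastMember []ᵥ           c≢∅ = ⊥-elim (c≢∅ refl)
leastMember (true  ∷ᵥ c) _   = fzero , _ , λ _ ()
leastMember (false ∷ᵥ c) c≢∅ with leastMember c (c≢∅ ∘ cong (false ∷ᵥ_))
... | m , cm , least = fsuc m , cm , λ { fzero _ → id ; (fsuc j) (s≤s j<m) → least j j<m }

∑-minima-of-class : ∀ {R : Fin n → Fin n → Bool} {c} →
  IsEquivalence ⟦ R ⟧ → EmptyOrClass R c → c ≢ ∅ →
  ∑[ i ∈ allFin n ] 𝟙 (isMin R i ∧ ⌊ c ≟ᵥ row R i ⌋) ≡ 1
∑-minima-of-class {R = R} {c} eq block c≢∅ with leastMember c c≢∅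
... | m , cm , least =
  trans (∑-allFin-point m other-i) (𝟙-T (Equivalence.from (T-∧ {isMin R m}) (min-m , fromWitness c≡row-m)))
  where
  c≡row-m : c ≡ row R m
  c≡row-m = emptyOrClass⇒≡row block cm
  min-m : T (isMin R m)
  min-m = Equivalence.from (isMin-correct {R = R}) λ j j<m Rjm →
    least j j<m (EmptyOrClass.closed block cm (IsEquivalence.sym eq Rjm))
  other-i : ∀ i → i ≢ m → 𝟙 (isMin R i ∧ ⌊ c ≟ᵥ row R i ⌋) ≡ 0
  other-i i i≢m = 𝟙-¬T λ t →
    let min-i , c≡row-i = Equivalence.to (T-∧ {isMin R i}) t
        Rim = subst T (Vec.lookup∘tabulate (R i) m) (subst (λ v → T (lookup v m)) (toWitness c≡row-i) cm)
    in i≢m (isMin-unique eq min-i min-m Rim)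

𝟙-emptyOrClass : ∀ {R : Fin n → Fin n → Bool} → IsEquivalence ⟦ R ⟧ → {p : Vec Bool n → Bool} →
  (∀ c → T (p c) ⇔ EmptyOrClass R c) → ∀ c →
  𝟙 (p c) ≡ 𝟙 ⌊ c ≟ᵥ ∅ ⌋ + ∑[ i ∈ allFin n ] 𝟙 (isMin R i ∧ ⌊ c ≟ᵥ row R i ⌋)
𝟙-emptyOrClass {n} {R} eq {p} spec c with p c in pc | c ≟ᵥ ∅
... | true  | yes refl = sym (cong suc (∑-zero (allFin n) λ i →
  𝟙-¬T (row-nonempty eq i ∘ sym ∘ toWitness ∘ proj₂ ∘ Equivalence.to (T-∧ {isMin R i}))))
... | true  | no c≢∅   = sym (∑-minima-of-class eq (Equivalence.to (spec c) (subst T (sym pc) _)) c≢∅)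
... | false | c≟∅      = sym (cong₂ _+_ (𝟙-¬T {⌊ c≟∅ ⌋} (not-block ∘ is-∅ ∘ toWitness))
  (∑-zero (allFin n) λ i → 𝟙-¬T (not-block ∘ is-row i ∘ toWitness ∘ proj₂ ∘ Equivalence.to (T-∧ {isMin R i}))))
  where
  not-block : ¬ EmptyOrClass R c
  not-block block = subst T pc (Equivalence.from (spec c) block)
  is-∅ : c ≡ ∅ → EmptyOrClass R c
  is-∅ refl = emptyOrClass-∅
  is-row : ∀ i → c ≡ row R i → EmptyOrClass R c
  is-row i refl = emptyOrClass-row eq i

∑-emptyOrClass : ∀ {R : Fin n → Fin n → Bool} → IsEquivalence ⟦ R ⟧ → {p : Vec Bool n → Bool} →
  (∀ c → T (p c) ⇔ EmptyOrClass R c) → (f : Vec Bool n → ℕ) →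
  ∑[ c ∈ allBoolVecs n ] (𝟙 (p c) * f c) ≡ f ∅ + ∑[ i ∈ allFin n ] (𝟙 (isMin R i) * f (row R i))
∑-emptyOrClass {n} {R} eq {p} spec f = begin
  ∑[ c ∈ Cs ] (𝟙 (p c) * f c)
    ≡⟨ ∑-cong Cs expand ⟩
  ∑[ c ∈ Cs ] (𝟙 ⌊ c ≟ᵥ ∅ ⌋ * f c + ∑[ i ∈ allFin n ] (δ-row i c * f c))
    ≡⟨ ∑-+ Cs _ _ ⟩
  ∑[ c ∈ Cs ] (𝟙 ⌊ c ≟ᵥ ∅ ⌋ * f c) + ∑[ c ∈ Cs ] ∑[ i ∈ allFin n ] (δ-row i c * f c)
    ≡⟨ cong₂ _+_ (∑-allBoolVecs-δ ∅ f) (∑-swap Cs (allFin n) _) ⟩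
  f ∅ + ∑[ i ∈ allFin n ] ∑[ c ∈ Cs ] (δ-row i c * f c)
    ≡⟨ cong (f ∅ +_) (∑-cong (allFin n) collapse) ⟩
  f ∅ + ∑[ i ∈ allFin n ] (𝟙 (isMin R i) * f (row R i)) ∎
  where
  open ≡-Reasoning
  Cs = allBoolVecs n
  δ-row : Fin n → Vec Bool n → ℕ
  δ-row i c = 𝟙 (isMin R i ∧ ⌊ c ≟ᵥ row R i ⌋)
  expand : ∀ c → 𝟙 (p c) * f c ≡ 𝟙 ⌊ c ≟ᵥ ∅ ⌋ * f c + ∑[ i ∈ allFin n ] (δ-row i c * f c)
  expand c = trans (cong (_* f c) (𝟙-emptyOrClass eq spec c))
    (trans (*-distribʳ-+ (f c) (𝟙 ⌊ c ≟ᵥ ∅ ⌋) _)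
           (cong (𝟙 ⌊ c ≟ᵥ ∅ ⌋ * f c +_) (sym (∑-*ʳ (allFin n) _ (f c)))))
  collapse : ∀ i → ∑[ c ∈ Cs ] (δ-row i c * f c) ≡ 𝟙 (isMin R i) * f (row R i)
  collapse i = trans
    (∑-cong Cs λ c → trans (cong (_* f c) (𝟙-∧ (isMin R i) _)) (*-assoc (𝟙 (isMin R i)) _ (f c)))
    (trans (∑-*ˡ Cs (𝟙 (isMin R i)) _) (cong (𝟙 (isMin R i) *_) (∑-allBoolVecs-δ (row R i) f)))

countMinimaOutside-∅ : (R : Fin n → Fin n → Bool) → countMinimaOutside ∅ R ≡ countMinima R
countMinimaOutside-∅ {n} R =
  ∑-cong (allFin n) λ i → cong (λ b → 𝟙 (not b ∧ isMin R i)) (Vec.lookup-replicate i false)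

countMinimaOutside-row : ∀ {R : Fin n → Fin n → Bool} {i} → IsEquivalence ⟦ R ⟧ → T (isMin R i) →
  suc (countMinimaOutside (row R i) R) ≡ countMinima R
countMinimaOutside-row {n} {R} {i} eq min-i = sym (begin
  countMinima R
    ≡⟨ ∑-cong (allFin n) (λ j → 𝟙-split (R i j)) ⟩
  ∑[ j ∈ allFin n ] (𝟙 (R i j ∧ isMin R j) + 𝟙 (not (R i j) ∧ isMin R j))
    ≡⟨ ∑-+ (allFin n) _ _ ⟩
  ∑[ j ∈ allFin n ] 𝟙 (R i j ∧ isMin R j) + ∑[ j ∈ allFin n ] 𝟙 (not (R i j) ∧ isMin R j)
    ≡⟨ cong₂ _+_ (trans (∑-allFin-point i other-j) (𝟙-T (Equivalence.from (T-∧ {R i i}) (E.refl , min-i))))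
                 (∑-cong (allFin n) λ j → cong (λ b → 𝟙 (not b ∧ isMin R j)) (sym (lookup-row j))) ⟩
  suc (countMinimaOutside (row R i) R) ∎)
  where
  open ≡-Reasoning
  𝟙-split : ∀ a {b} → 𝟙 b ≡ 𝟙 (a ∧ b) + 𝟙 (not a ∧ b)
  𝟙-split true  = sym (+-identityʳ _)
  𝟙-split false = refl
  other-j : ∀ j → j ≢ i → 𝟙 (R i j ∧ isMin R j) ≡ 0
  other-j j j≢i = 𝟙-¬T λ t →
    let Rij , min-j = Equivalence.to (T-∧ {R i j}) t in j≢i (sym (isMin-unique eq min-i min-j Rij))
  module E = IsEquivalence eq
  lookup-row : ∀ j → lookup (row R i) j ≡ R i j
  lookup-row = Vec.lookup∘tabulate (R i)

∑-bordered-diagonal-classes : (M : Rel n) (k : ℕ) →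
  ∑[ c ∈ allBoolVecs n ] (𝟙 (isEquivRel (bordered true c c M)) * 𝟙 (suc (countMinimaOutside c (rel M)) ≡ᵇ k))
    ≡ 𝟙 (isEquivRel M ∧ (suc (numClasses M) ≡ᵇ k)) + k * 𝟙 (isEquivRel M ∧ (numClasses M ≡ᵇ k))
∑-bordered-diagonal-classes {n} M k with isEquivRel M in M-equiv
... | false = trans (∑-zero (allBoolVecs n) λ c → cong (_* f c) (𝟙-¬T (not-equiv c))) (sym (*-zeroʳ k))
  where
  f : Vec Bool n → ℕ
  f c = 𝟙 (suc (countMinimaOutside c (rel M)) ≡ᵇ k)
  not-equiv : ∀ c → ¬ T (isEquivRel (bordered true c c M))
  not-equiv c t = subst T M-equiv (Equivalence.from (isEquivRel-correct M)
    (proj₁ (proj₂ (proj₂ (borderedRel-isEquivalence⁻ (Equivalence.to (isEquivRel-bordered true c c M) t))))))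
... | true = begin
  ∑[ c ∈ allBoolVecs n ] (𝟙 (isEquivRel (bordered true c c M)) * f c)
    ≡⟨ ∑-emptyOrClass eq spec f ⟩
  f ∅ + ∑[ i ∈ allFin n ] (𝟙 (isMin R i) * f (row R i))
    ≡⟨ cong₂ _+_ (cong (λ m → 𝟙 (suc m ≡ᵇ k)) (trans (countMinimaOutside-∅ R) (sym classes≡minima)))
                 (∑-cong (allFin n) minimum-term) ⟩
  𝟙 (suc (numClasses M) ≡ᵇ k) + ∑[ i ∈ allFin n ] (𝟙 (numClasses M ≡ᵇ k) * 𝟙 (isMin R i))
    ≡⟨ cong (𝟙 (suc (numClasses M) ≡ᵇ k) +_) (trans (∑-*ˡ (allFin n) (𝟙 (numClasses M ≡ᵇ k)) (𝟙 ∘ isMin R))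
         (trans (cong (𝟙 (numClasses M ≡ᵇ k) *_) (sym classes≡minima)) (𝟙≡ᵇ-* (numClasses M) k))) ⟩
  𝟙 (suc (numClasses M) ≡ᵇ k) + k * 𝟙 (numClasses M ≡ᵇ k) ∎
  where
  open ≡-Reasoning
  R = rel M
  classes≡minima = numClasses≡countMinima M
  f : Vec Bool n → ℕ
  f c = 𝟙 (suc (countMinimaOutside c R) ≡ᵇ k)
  eq : IsEquivalence ⟦ R ⟧
  eq = Equivalence.to (isEquivRel-correct M) (subst T (sym M-equiv) _)
  spec : ∀ c → T (isEquivRel (bordered true c c M)) ⇔ EmptyOrClass R c
  spec c = mk⇔
    (proj₂ ∘ proj₂ ∘ proj₂ ∘ borderedRel-isEquivalence⁻ ∘ Equivalence.to (isEquivRel-bordered true c c M))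
    (Equivalence.from (isEquivRel-bordered true c c M) ∘ borderedRel-isEquivalence⁺ eq)
  minimum-term : ∀ i → 𝟙 (isMin R i) * f (row R i) ≡ 𝟙 (numClasses M ≡ᵇ k) * 𝟙 (isMin R i)
  minimum-term i with isMin R i in min-i
  ... | false = sym (*-zeroʳ (𝟙 (numClasses M ≡ᵇ k)))
  ... | true  = trans (+-identityʳ _) (trans
    (cong (λ m → 𝟙 (m ≡ᵇ k)) (trans (countMinimaOutside-row eq (subst T (sym min-i) _)) (sym classes≡minima)))
    (sym (*-identityʳ (𝟙 (numClasses M ≡ᵇ k)))))

countBy-bordered : (M : Rel n) (k : ℕ) →
  ∑[ b ∈ allBools ] ∑[ r ∈ allBoolVecs n ] ∑[ c ∈ allBoolVecs n ]
    𝟙 (isEquivRel (bordered b r c M) ∧ (numClasses (bordered b r c M) ≡ᵇ k))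
    ≡ 𝟙 (isEquivRel M ∧ (suc (numClasses M) ≡ᵇ k)) + k * 𝟙 (isEquivRel M ∧ (numClasses M ≡ᵇ k))
countBy-bordered {n} M k = begin
  ∑[ b ∈ allBools ] ∑[ r ∈ allBoolVecs n ] ∑[ c ∈ allBoolVecs n ] F (bordered b r c M)
    ≡⟨ ∑-bordered-diagonal M F (λ M′ ¬equiv →
         𝟙-¬T (¬equiv ∘ proj₁ ∘ Equivalence.to (T-∧ {isEquivRel M′}))) ⟩
  ∑[ c ∈ allBoolVecs n ] F (bordered true c c M)
    ≡⟨ ∑-cong (allBoolVecs n) split ⟩
  ∑[ c ∈ allBoolVecs n ] (𝟙 (isEquivRel (bordered true c c M)) * 𝟙 (suc (countMinimaOutside c (rel M)) ≡ᵇ k))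
    ≡⟨ ∑-bordered-diagonal-classes M k ⟩
  𝟙 (isEquivRel M ∧ (suc (numClasses M) ≡ᵇ k)) + k * 𝟙 (isEquivRel M ∧ (numClasses M ≡ᵇ k)) ∎
  where
  open ≡-Reasoning
  F : Rel (suc n) → ℕ
  F M′ = 𝟙 (isEquivRel M′ ∧ (numClasses M′ ≡ᵇ k))
  split : ∀ c → F (bordered true c c M)
              ≡ 𝟙 (isEquivRel (bordered true c c M)) * 𝟙 (suc (countMinimaOutside c (rel M)) ≡ᵇ k)
  split c = trans
    (cong (λ m → 𝟙 (isEquivRel (bordered true c c M) ∧ (m ≡ᵇ k)))
          (trans (numClasses≡countMinima (bordered true c c M)) (countMinima-bordered true c c M)))
    (𝟙-∧ (isEquivRel (bordered true c c M)) _)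

stirling2≡S₂ : ∀ n k → stirling2 n k ≡ S₂ n k
stirling2≡S₂ n k =
  trans (length-filter-≟true _ (allRels n)) (countBy≡S₂ allRels isEquivRel numClasses base step n k)
  where
  base : ∀ k → countBy isEquivRel numClasses (allRels 0) k ≡ S₂ 0 k
  base zero    = refl
  base (suc k) = refl
  step : ∀ n k → countBy isEquivRel numClasses (allRels (suc n)) k
               ≡ countBy isEquivRel (suc ∘ numClasses) (allRels n) k + k * countBy isEquivRel numClasses (allRels n) k
  step n k = trans (∑-allRels-suc {n} λ M → 𝟙 (isEquivRel M ∧ (numClasses M ≡ᵇ k)))
    (countBy-children isEquivRel numClasses (allRels n) _ (λ {M} _ → countBy-bordered M) k)

-- The identity holds for all n and k.
theorem11 : (n k : ℕ) → 1 ≤ n → 1 ≤ k → k ≤ n →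
    countInv011Zeros n k ≡ stirling2 n k
theorem11 n k _ _ _ = trans (countInv011Zeros≡S₂ n k) (sym (stirling2≡S₂ n k))
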